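{- For every integer $n\geq 3$ there exists a connected very well-covered graph $H$ that is not a tree, such that $\alpha(H)=n$ and the independence polynomial $I(H;x)$ is unimodal.
   Context: All graphs are simple (finite, undirected, no loops or multiple edges). A stable set is a set of pairwise non-adjacent vertices; $\alpha(G)$ is the maximum size of a stable set in $G$. If $s_k$ denotes the number of stable sets of cardinality $k$ in $G$, the independence polynomial is $I(G;x)=\sum_{k=0}^{\alpha(G)} s_k x^k$; it is unimodal if there is an index $k$ with $s_0\leq s_1\leq\cdots\leq s_k\geq s_{k+1}\geq\cdots\geq s_{\alpha(G)}$. A graph is well-covered if all its maximal stable sets have the same cardinality; it is very well-covered if it is well-covered, has no isolated vertices, and its number of vertices equals $2\alpha(G)$. -}

module Defs where

open import Data.Nat using (ℕ; zero; suc; _≤_; _<_; _*_)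
import Data.Nat as ℕ
open import Data.Bool using (Bool; true; false)
import Data.Bool.Properties as BoolP
open import Data.Fin using (Fin)
open import Data.Fin.Properties using (all?)
open import Data.Fin.Subset using (Subset; _∈_; _∉_; ∣_∣; _∪_; ⁅_⁆)
open import Data.Fin.Subset.Properties using (_∈?_)
open import Data.Vec using (Vec; []; _∷_)
open import Data.List using (List; []; _∷_; [_]; _++_; map; filter; length; _∷ʳ_)
open import Data.List.Relation.Unary.Unique.Propositional using (Unique)
open import Data.Product using (Σ; _×_; ∃; ∃-syntax)
open import Data.Unit using (⊤)
open import Relation.Binary.PropositionalEquality using (_≡_)
open import Relation.Nullary using (¬_; Dec)
open import Relation.Nullary.Decidable using (_×-dec_; _→-dec_)

record SimpleGraph (n : ℕ) : Set where
  field
    adj     : Fin n → Fin n → Bool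
    symm    : ∀ u v → adj u v ≡ adj v u
    irrefl  : ∀ v → adj v v ≡ false
open SimpleGraph public

module _ {n : ℕ} (G : SimpleGraph n) where

  Adj : Fin n → Fin n → Set
  Adj u v = adj G u v ≡ true

  Stable : Subset n → Set
  Stable S = ∀ u v → u ∈ S → v ∈ S → adj G u v ≡ false

  Stable? : (S : Subset n) → Dec (Stable S)
  Stable? S = all? λ u → all? λ v →
    (u ∈? S) →-dec ((v ∈? S) →-dec (adj G u v BoolP.≟ false))

  MaximalStable : Subset n → Set
  MaximalStable S = Stable S × (∀ v → v ∉ S → ¬ Stable (S ∪ ⁅ v ⁆))

  IsAlpha : ℕ → Set
  IsAlpha a = (∃[ S ] (Stable S × ∣ S ∣ ≡ a)) × (∀ S → Stable S → ∣ S ∣ ≤ a)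

  WellCovered : Set
  WellCovered = ∀ S T → MaximalStable S → MaximalStable T → ∣ S ∣ ≡ ∣ T ∣

  NoIsolated : Set
  NoIsolated = ∀ v → ∃[ u ] Adj v u

  VeryWellCovered : Set
  VeryWellCovered = WellCovered × NoIsolated × (∃[ a ] (IsAlpha a × n ≡ 2 * a))

  data Walk : Fin n → Fin n → Set where
    here : ∀ {u} → Walk u u
    step : ∀ {u v w} → Adj u v → Walk v w → Walk u w

  Connected : Set
  Connected = ∀ u v → Walk u v

  Chain : Fin n → List (Fin n) → Set
  Chain x []       = ⊤
  Chain x (y ∷ ys) = Adj x y × Chain y ys

  -- A cycle: distinct vertices u, ws…, w (at least 3 in total), consecutive
  -- ones adjacent, and w adjacent to u.
  HasCycle : Set
  HasCycle = ∃[ u ] ∃[ w ] ∃[ ws ]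
    (Unique (u ∷ (ws ∷ʳ w)) × 1 ≤ length ws × Chain u (ws ∷ʳ w) × Adj w u)

  Acyclic : Set
  Acyclic = ¬ HasCycle

  IsTree : Set
  IsTree = Connected × Acyclic

allSubsets : (n : ℕ) → List (Subset n)
allSubsets zero    = [ [] ]
allSubsets (suc n) = map (false ∷_) (allSubsets n) ++ map (true ∷_) (allSubsets n)

module _ {n : ℕ} (G : SimpleGraph n) where

  stableCount : ℕ → ℕ
  stableCount k = length (filter (λ S → Stable? G S ×-dec (∣ S ∣ ℕ.≟ k)) (allSubsets n))

UnimodalSeq : (ℕ → ℕ) → ℕ → Set
UnimodalSeq s a = ∃[ k ] (k ≤ a × (∀ i → i < k → s i ≤ s (suc i))
                                 × (∀ i → k ≤ i → i < a → s (suc i) ≤ s i))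

-- I(G;x) = Σ_{k=0}^{α(G)} s_k x^k is unimodal.
IndependencePolyUnimodal : {n : ℕ} → SimpleGraph n → Set
IndependencePolyUnimodal G = ∃[ a ] (IsAlpha G a × UnimodalSeq (stableCount G) a)

{-# OPTIONS --safe #-}
module Submission where

-- The graph is the corona Kₙ ∘ K₁: a clique on n vertices with a pendant leaf attached to
-- each of them.  Its n pendant edges partition the vertex set, and a stable set meeting no
-- pendant edge can be extended by that edge's leaf; so every maximal stable set has exactly
-- n vertices, and the graph is very well-covered with α = n.  A stable set holds at most
-- one clique vertex, which gives s_k = C(n,k) + k C(n,k) = (k+1) C(n,k), and this sequence
-- increases up to ⌈n/2⌉ and decreases afterwards.  For n ≥ 3 three clique vertices form a
-- triangle, so the graph is not a tree.

open import Defs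
open import Data.Nat using (ℕ; zero; suc; _+_; _*_; _≤_; _<_; _≡ᵇ_; z≤n; s≤s; ⌈_/2⌉)
open import Data.Nat.Properties
open import Data.Nat.Combinatorics using (_C_; nC1≡n; nCk+nC[k+1]≡[n+1]C[k+1])
open import Data.Nat.Solver using (module +-*-Solver)
open import Data.Bool using (Bool; true; false; T; T?; not; _∧_)
open import Data.Bool.Properties using (∧-zeroʳ)
open import Data.Fin using (Fin; zero; suc)
open import Data.Fin.Subset using (Subset; _∈_; _∉_; ∣_∣; _∪_; ⁅_⁆)
open import Data.Fin.Subset.Properties using (∪-identityʳ; drop-there)
open import Data.Vec using ([]; _∷_; here; there)
open import Data.List using (List; []; _∷_; _++_; length; map; filter; filterᵇ)
open import Data.List.Properties using (length-++; filter-++)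
open import Data.List.Relation.Unary.All using ([]; _∷_)
open import Data.List.Relation.Unary.AllPairs using ([]; _∷_)
open import Data.Product using (Σ; _×_; _,_; ∃-syntax)
open import Data.Sum as Sum using (_⊎_; inj₁; inj₂)
open import Data.Empty using (⊥-elim)
open import Data.Unit using (tt)
open import Function using (_∘_)
open import Relation.Nullary using (¬_; does; proof)
open import Relation.Nullary.Decidable using (_×-dec_)
open import Relation.Nullary.Reflects using (fromEquivalence; det)
open import Relation.Unary using (Pred; Decidable)
open import Relation.Binary.PropositionalEquality
  using (_≡_; _≢_; _≗_; refl; sym; trans; cong; cong₂; subst; subst₂; module ≡-Reasoning)

open +-*-Solver

[k+1]*nC[k+1]+k*nCk≡n*nCk : ∀ n k → suc k * (n C suc k) + k * (n C k) ≡ n * (n C k)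
[k+1]*nC[k+1]+k*nCk≡n*nCk zero    zero    = refl
[k+1]*nC[k+1]+k*nCk≡n*nCk zero    (suc k) = cong₂ _+_ (*-zeroʳ (2 + k)) (*-zeroʳ (1 + k))
[k+1]*nC[k+1]+k*nCk≡n*nCk (suc n) zero    =
  trans (+-identityʳ _) (trans (*-identityˡ _) (trans (nC1≡n (suc n)) (sym (*-identityʳ _))))
[k+1]*nC[k+1]+k*nCk≡n*nCk (suc n) (suc k) = begin
  (2 + k) * (suc n C (2 + k)) + (1 + k) * (suc n C (1 + k))
    ≡⟨ cong₂ _+_ (cong ((2 + k) *_) (nCk+nC[k+1]≡[n+1]C[k+1] n (suc k)))
                 (cong ((1 + k) *_) (nCk+nC[k+1]≡[n+1]C[k+1] n k)) ⟨
  (2 + k) * (b₁ + b₂) + (1 + k) * (b₀ + b₁)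
    ≡⟨ solve 4 (λ k b₀ b₁ b₂ → (con 2 :+ k) :* (b₁ :+ b₂) :+ (con 1 :+ k) :* (b₀ :+ b₁)
                 := ((con 2 :+ k) :* b₂ :+ (con 1 :+ k) :* b₁) :+ ((con 1 :+ k) :* b₁ :+ k :* b₀)
                    :+ (b₀ :+ b₁)) refl k b₀ b₁ b₂ ⟩
  ((2 + k) * b₂ + (1 + k) * b₁) + ((1 + k) * b₁ + k * b₀) + (b₀ + b₁)
    ≡⟨ cong (λ x → x + (b₀ + b₁)) (cong₂ _+_ ([k+1]*nC[k+1]+k*nCk≡n*nCk n (suc k))
                                             ([k+1]*nC[k+1]+k*nCk≡n*nCk n k)) ⟩
  n * b₁ + n * b₀ + (b₀ + b₁)
    ≡⟨ solve 3 (λ n b₀ b₁ → n :* b₁ :+ n :* b₀ :+ (b₀ :+ b₁) := (con 1 :+ n) :* (b₀ :+ b₁))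
             refl n b₀ b₁ ⟩
  (1 + n) * (b₀ + b₁)
    ≡⟨ cong (suc n *_) (nCk+nC[k+1]≡[n+1]C[k+1] n k) ⟩
  (1 + n) * (suc n C (1 + k)) ∎
  where
  open ≡-Reasoning
  b₀ = n C k
  b₁ = n C suc k
  b₂ = n C suc (suc k)

2k+1≤n⇒nCk≤nC[k+1] : ∀ {n k} → suc k + k ≤ n → n C k ≤ n C suc k
2k+1≤n⇒nCk≤nC[k+1] {n} {k} 2k+1≤n = *-cancelˡ-≤ (suc k) (+-cancelʳ-≤ (k * (n C k)) _ _ (begin
  suc k * (n C k) + k * (n C k)    ≡⟨ *-distribʳ-+ (n C k) (suc k) k ⟨
  (suc k + k) * (n C k)            ≤⟨ *-monoˡ-≤ (n C k) 2k+1≤n ⟩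
  n * (n C k)                      ≡⟨ [k+1]*nC[k+1]+k*nCk≡n*nCk n k ⟨
  suc k * (n C suc k) + k * (n C k) ∎))
  where open ≤-Reasoning

n≤2k⇒[k+2]*nC[k+1]≤[k+1]*nCk : ∀ {n k} → n ≤ k + k → (2 + k) * (n C suc k) ≤ (1 + k) * (n C k)
n≤2k⇒[k+2]*nC[k+1]≤[k+1]*nCk {n} {k} n≤2k = *-cancelˡ-≤ (suc k) (begin
  (1 + k) * ((2 + k) * b₁)    ≡⟨ solve 2 (λ k b₁ → (con 1 :+ k) :* ((con 2 :+ k) :* b₁)
                                                  := (con 2 :+ k) :* ((con 1 :+ k) :* b₁)) refl k b₁ ⟩
  (2 + k) * ((1 + k) * b₁)    ≤⟨ *-monoʳ-≤ (2 + k) [k+1]*nC[k+1]≤k*nCk ⟩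
  (2 + k) * (k * b₀)          ≤⟨ m≤m+n _ b₀ ⟩
  (2 + k) * (k * b₀) + b₀     ≡⟨ solve 2 (λ k b₀ → (con 2 :+ k) :* (k :* b₀) :+ b₀
                                                  := (con 1 :+ k) :* ((con 1 :+ k) :* b₀)) refl k b₀ ⟩
  (1 + k) * ((1 + k) * b₀)    ∎)
  where
  open ≤-Reasoning
  b₀ = n C k
  b₁ = n C suc k
  [k+1]*nC[k+1]≤k*nCk : (1 + k) * b₁ ≤ k * b₀
  [k+1]*nC[k+1]≤k*nCk = +-cancelʳ-≤ (k * b₀) _ _ (begin
    (1 + k) * b₁ + k * b₀     ≡⟨ [k+1]*nC[k+1]+k*nCk≡n*nCk n k ⟩
    n * b₀                    ≤⟨ *-monoˡ-≤ b₀ n≤2k ⟩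
    (k + k) * b₀              ≡⟨ *-distribʳ-+ b₀ k k ⟩
    k * b₀ + k * b₀           ∎)

UnimodalSeq-cong : ∀ {s t : ℕ → ℕ} {a} → s ≗ t → UnimodalSeq s a → UnimodalSeq t a
UnimodalSeq-cong s≗t (k , k≤a , up , down) =
  k , k≤a ,
  (λ i i<k → subst₂ _≤_ (s≗t i) (s≗t (suc i)) (up i i<k)) ,
  (λ i k≤i i<a → subst₂ _≤_ (s≗t (suc i)) (s≗t i) (down i k≤i i<a))

[k+1]*nCk-unimodal : ∀ n → UnimodalSeq (λ k → suc k * (n C k)) n
[k+1]*nCk-unimodal n = ⌈ n /2⌉ , ⌈n/2⌉≤n n , increasing , decreasing
  where
  h = ⌈ n /2⌉

  2h≤n+1 : h + h ≤ suc n
  2h≤n+1 = subst (h + h ≤_) (⌊n/2⌋+⌈n/2⌉≡n (suc n)) (+-monoʳ-≤ h (⌊n/2⌋≤⌈n/2⌉ (suc n)))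

  n≤2h : n ≤ h + h
  n≤2h = subst (_≤ h + h) (⌊n/2⌋+⌈n/2⌉≡n n) (+-monoˡ-≤ h (⌊n/2⌋≤⌈n/2⌉ n))

  increasing : ∀ i → i < h → suc i * (n C i) ≤ suc (suc i) * (n C suc i)
  increasing i i<h = *-mono-≤ (n≤1+n (suc i)) (2k+1≤n⇒nCk≤nC[k+1] 2i+1≤n)
    where
    2i+1≤n : suc i + i ≤ n
    2i+1≤n = subst (_≤ n) (+-suc i i) (≤-pred (≤-trans (+-mono-≤ i<h i<h) 2h≤n+1))

  decreasing : ∀ i → h ≤ i → i < n → suc (suc i) * (n C suc i) ≤ suc i * (n C i)
  decreasing i h≤i _ = n≤2k⇒[k+2]*nC[k+1]≤[k+1]*nCk (≤-trans n≤2h (+-mono-≤ h≤i h≤i))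

module _ {a p q} {A : Set a} {P : Pred A p} {Q : Pred A q} where

  filter-does-cong : (P? : Decidable P) (Q? : Decidable Q) →
                     (∀ x → does (P? x) ≡ does (Q? x)) → filter P? ≗ filter Q?
  filter-does-cong P? Q? eq []       = refl
  filter-does-cong P? Q? eq (x ∷ xs) with does (P? x) | does (Q? x) | eq x
  ... | true  | .true  | refl = cong (x ∷_) (filter-does-cong P? Q? eq xs)
  ... | false | .false | refl = filter-does-cong P? Q? eq xs

module _ {a b p} {A : Set a} {B : Set b} {P : Pred B p} where

  length-filter-map : (P? : Decidable P) (f : A → B) (xs : List A) →
                      length (filter P? (map f xs)) ≡ length (filter (P? ∘ f) xs)
  length-filter-map P? f []       = refl
  length-filter-map P? f (x ∷ xs) with does (P? (f x))
  ... | true  = cong suc (length-filter-map P? f xs)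
  ... | false = length-filter-map P? f xs

filterᵇ-none : ∀ {a} {A : Set a} {p : A → Bool} → (∀ x → p x ≡ false) → ∀ xs → filterᵇ p xs ≡ []
filterᵇ-none p≡false []       = refl
filterᵇ-none p≡false (x ∷ xs) rewrite p≡false x = filterᵇ-none p≡false xs

#subsets : ∀ {d} → (Subset d → Bool) → ℕ → ℕ
#subsets {d} p k = length (filterᵇ (λ S → p S ∧ (∣ S ∣ ≡ᵇ k)) (allSubsets d))

#subsets-cong : ∀ {d} {p q : Subset d → Bool} → p ≗ q → ∀ k → #subsets p k ≡ #subsets q k
#subsets-cong {d} {p} {q} p≗q k = cong length (filter-does-cong
  (λ S → T? (p S ∧ (∣ S ∣ ≡ᵇ k))) (λ S → T? (q S ∧ (∣ S ∣ ≡ᵇ k)))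
  (λ S → cong (_∧ (∣ S ∣ ≡ᵇ k)) (p≗q S)) (allSubsets d))

-- ∣ false ∷ S ∣ reduces to ∣ S ∣ and ∣ true ∷ S ∣ to suc ∣ S ∣.
#subsets-split : ∀ {d} (p : Subset (suc d) → Bool) k →
  #subsets p k ≡ #subsets (λ S → p (false ∷ S)) k
               + length (filterᵇ (λ S → p (true ∷ S) ∧ (suc ∣ S ∣ ≡ᵇ k)) (allSubsets d))
#subsets-split {d} p k = begin
  length (filter P? (map (false ∷_) (allSubsets d) ++ map (true ∷_) (allSubsets d)))
    ≡⟨ cong length (filter-++ P? (map (false ∷_) (allSubsets d)) _) ⟩
  length (filter P? (map (false ∷_) (allSubsets d)) ++ filter P? (map (true ∷_) (allSubsets d)))
    ≡⟨ length-++ (filter P? (map (false ∷_) (allSubsets d))) ⟩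
  length (filter P? (map (false ∷_) (allSubsets d))) + length (filter P? (map (true ∷_) (allSubsets d)))
    ≡⟨ cong₂ _+_ (length-filter-map P? (false ∷_) (allSubsets d))
                 (length-filter-map P? (true ∷_) (allSubsets d)) ⟩
  _ ∎
  where
  open ≡-Reasoning
  P? = T? ∘ (λ S → p S ∧ (∣ S ∣ ≡ᵇ k))

#subsets-zero : ∀ {d} (p : Subset (suc d) → Bool) → #subsets p 0 ≡ #subsets (λ S → p (false ∷ S)) 0
#subsets-zero {d} p = trans (#subsets-split p 0) (trans
  (cong (#subsets (λ S → p (false ∷ S)) 0 +_)
        (cong length (filterᵇ-none (λ S → ∧-zeroʳ (p (true ∷ S))) (allSubsets d))))
  (+-identityʳ _))

#subsets-suc : ∀ {d} (p : Subset (suc d) → Bool) k →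
  #subsets p (suc k) ≡ #subsets (λ S → p (false ∷ S)) (suc k) + #subsets (λ S → p (true ∷ S)) k
#subsets-suc p k = #subsets-split p (suc k)

#subsets-avoiding-0 : ∀ {d} (p : Subset (suc d) → Bool) → (∀ S → p (true ∷ S) ≡ false) →
  ∀ k → #subsets p k ≡ #subsets (λ S → p (false ∷ S)) k
#subsets-avoiding-0 {d} p 0∉p k = trans (#subsets-split p k) (trans
  (cong (#subsets (λ S → p (false ∷ S)) k +_)
        (cong length (filterᵇ-none (λ S → cong (_∧ (suc ∣ S ∣ ≡ᵇ k)) (0∉p S)) (allSubsets d))))
  (+-identityʳ _))

stableCount≡#subsets : ∀ {m} (G : SimpleGraph m) k → stableCount G k ≡ #subsets (does ∘ Stable? G) k
stableCount≡#subsets {m} G k = cong length (filter-does-cong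
  (λ S → Stable? G S ×-dec (∣ S ∣ ≟ k)) (λ S → T? (does (Stable? G S) ∧ (∣ S ∣ ≡ᵇ k)))
  (λ _ → refl) (allSubsets m))

module _ {m} (G : SimpleGraph m) where

  walk-++ : ∀ {u v w} → Walk G u v → Walk G v w → Walk G u w
  walk-++ here        q = q
  walk-++ (step uv p) q = step uv (walk-++ p q)

  walk-reverse : ∀ {u v} → Walk G u v → Walk G v u
  walk-reverse here                    = here
  walk-reverse {u} (step {v = v} uv p) = walk-++ (walk-reverse p) (step (trans (symm G v u) uv) here)

  allReach⇒Connected : ∀ r → (∀ v → Walk G v r) → Connected G
  allReach⇒Connected r reach u v = walk-++ (reach u) (walk-reverse (reach v))

  triangle⇒HasCycle : ∀ {u v w} → u ≢ v → u ≢ w → v ≢ w →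
                      Adj G u v → Adj G v w → Adj G w u → HasCycle G
  triangle⇒HasCycle u≢v u≢w v≢w uv vw wu =
    _ , _ , _ ∷ [] , ((u≢v ∷ u≢w ∷ []) ∷ (v≢w ∷ []) ∷ [] ∷ []) , s≤s z≤n , (uv , vw , tt) , wu

double : ℕ → ℕ
double zero    = zero
double (suc n) = suc (suc (double n))

double≡2* : ∀ n → double n ≡ 2 * n
double≡2* zero    = refl
double≡2* (suc n) = cong suc (trans (cong suc (double≡2* n)) (sym (+-suc n (n + 0))))

-- Vertex 2i is the i-th vertex of the clique and vertex 2i+1 is the leaf attached to it.
isClique : ∀ {n} → Fin (double n) → Bool
isClique {suc n} zero          = true
isClique {suc n} (suc zero)    = false
isClique {suc n} (suc (suc v)) = isClique {n} v

corona-adj : ∀ n → Fin (double n) → Fin (double n) → Bool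
corona-adj (suc n) zero          zero          = false
corona-adj (suc n) zero          (suc zero)    = true
corona-adj (suc n) zero          (suc (suc v)) = isClique v
corona-adj (suc n) (suc zero)    zero          = true
corona-adj (suc n) (suc zero)    (suc _)       = false
corona-adj (suc n) (suc (suc u)) zero          = isClique u
corona-adj (suc n) (suc (suc u)) (suc zero)    = false
corona-adj (suc n) (suc (suc u)) (suc (suc v)) = corona-adj n u v

corona-adj-sym : ∀ n u v → corona-adj n u v ≡ corona-adj n v u
corona-adj-sym (suc n) zero          zero          = refl
corona-adj-sym (suc n) zero          (suc zero)    = refl
corona-adj-sym (suc n) zero          (suc (suc v)) = refl
corona-adj-sym (suc n) (suc zero)    zero          = refl
corona-adj-sym (suc n) (suc zero)    (suc zero)    = refl
corona-adj-sym (suc n) (suc zero)    (suc (suc v)) = refl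
corona-adj-sym (suc n) (suc (suc u)) zero          = refl
corona-adj-sym (suc n) (suc (suc u)) (suc zero)    = refl
corona-adj-sym (suc n) (suc (suc u)) (suc (suc v)) = corona-adj-sym n u v

corona-adj-irrefl : ∀ n v → corona-adj n v v ≡ false
corona-adj-irrefl (suc n) zero          = refl
corona-adj-irrefl (suc n) (suc zero)    = refl
corona-adj-irrefl (suc n) (suc (suc v)) = corona-adj-irrefl n v

corona : ∀ n → SimpleGraph (double n)
corona n = record { adj = corona-adj n ; symm = corona-adj-sym n ; irrefl = corona-adj-irrefl n }

leavesOnly : ∀ n → Subset (double n) → Bool
leavesOnly zero    []          = true
leavesOnly (suc n) (x ∷ _ ∷ S) = not x ∧ leavesOnly n S

isStable : ∀ n → Subset (double n) → Bool
isStable zero    []              = true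
isStable (suc n) (false ∷ _ ∷ S) = isStable n S
isStable (suc n) (true  ∷ y ∷ S) = not y ∧ leavesOnly n S

leavesOnly⇒isStable : ∀ n S → T (leavesOnly n S) → T (isStable n S)
leavesOnly⇒isStable zero    []              _ = tt
leavesOnly⇒isStable (suc n) (false ∷ _ ∷ S) h = leavesOnly⇒isStable n S h

leavesOnly⇒¬isClique : ∀ n S v → T (leavesOnly n S) → v ∈ S → isClique v ≡ false
leavesOnly⇒¬isClique (suc n) (false ∷ _ ∷ S) (suc zero)    _ _                 = refl
leavesOnly⇒¬isClique (suc n) (false ∷ _ ∷ S) (suc (suc v)) h (there (there v∈S)) =
  leavesOnly⇒¬isClique n S v h v∈S

¬isClique⇒leavesOnly : ∀ n S → (∀ v → v ∈ S → isClique v ≡ false) → T (leavesOnly n S)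
¬isClique⇒leavesOnly zero    []              _     = tt
¬isClique⇒leavesOnly (suc n) (true  ∷ _ ∷ S) ¬cl with ¬cl zero here
... | ()
¬isClique⇒leavesOnly (suc n) (false ∷ _ ∷ S) ¬cl =
  ¬isClique⇒leavesOnly n S (λ v v∈S → ¬cl (suc (suc v)) (there (there v∈S)))

isStable⇒Stable : ∀ n S → T (isStable n S) → Stable (corona n) S
isStable⇒Stable (suc n) (false ∷ _ ∷ S) h (suc zero) (suc zero) _ _ = refl
isStable⇒Stable (suc n) (false ∷ _ ∷ S) h (suc zero) (suc (suc v)) _ _ = refl
isStable⇒Stable (suc n) (false ∷ _ ∷ S) h (suc (suc u)) (suc zero) _ _ = refl
isStable⇒Stable (suc n) (false ∷ _ ∷ S) h (suc (suc u)) (suc (suc v))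
                (there (there u∈S)) (there (there v∈S)) = isStable⇒Stable n S h u v u∈S v∈S
isStable⇒Stable (suc n) (true ∷ false ∷ S) h zero zero _ _ = refl
isStable⇒Stable (suc n) (true ∷ false ∷ S) h zero (suc (suc v)) _ (there (there v∈S)) =
  leavesOnly⇒¬isClique n S v h v∈S
isStable⇒Stable (suc n) (true ∷ false ∷ S) h (suc (suc u)) zero (there (there u∈S)) _ =
  leavesOnly⇒¬isClique n S u h u∈S
isStable⇒Stable (suc n) (true ∷ false ∷ S) h (suc (suc u)) (suc (suc v))
                (there (there u∈S)) (there (there v∈S)) =
  isStable⇒Stable n S (leavesOnly⇒isStable n S h) u v u∈S v∈S

Stable⇒isStable : ∀ n S → Stable (corona n) S → T (isStable n S)
Stable⇒isStable zero    []                  _  = tt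
Stable⇒isStable (suc n) (false ∷ _ ∷ S)     st = Stable⇒isStable n S
  (λ u v u∈S v∈S → st (suc (suc u)) (suc (suc v)) (there (there u∈S)) (there (there v∈S)))
Stable⇒isStable (suc n) (true  ∷ false ∷ S) st = ¬isClique⇒leavesOnly n S
  (λ v v∈S → st zero (suc (suc v)) here (there (there v∈S)))
Stable⇒isStable (suc n) (true  ∷ true  ∷ S) st with st zero (suc zero) here (there here)
... | ()

does-Stable? : ∀ n S → does (Stable? (corona n) S) ≡ isStable n S
does-Stable? n S = det (proof (Stable? (corona n) S))
                       (fromEquivalence (isStable⇒Stable n S) (Stable⇒isStable n S))

leaves : ∀ n → Subset (double n)
leaves zero    = []
leaves (suc n) = false ∷ true ∷ leaves n

isStable-leaves : ∀ n → T (isStable n (leaves n))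
isStable-leaves zero    = tt
isStable-leaves (suc n) = isStable-leaves n

∣leaves∣≡n : ∀ n → ∣ leaves n ∣ ≡ n
∣leaves∣≡n zero    = refl
∣leaves∣≡n (suc n) = cong suc (∣leaves∣≡n n)

isStable⇒∣S∣≤n : ∀ n S → T (isStable n S) → ∣ S ∣ ≤ n
isStable⇒∣S∣≤n zero    []                  _ = z≤n
isStable⇒∣S∣≤n (suc n) (false ∷ false ∷ S) h = m≤n⇒m≤1+n (isStable⇒∣S∣≤n n S h)
isStable⇒∣S∣≤n (suc n) (false ∷ true  ∷ S) h = s≤s (isStable⇒∣S∣≤n n S h)
isStable⇒∣S∣≤n (suc n) (true  ∷ false ∷ S) h = s≤s (isStable⇒∣S∣≤n n S (leavesOnly⇒isStable n S h))

corona-α : ∀ n → IsAlpha (corona n) n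
corona-α n = (leaves n , isStable⇒Stable n (leaves n) (isStable-leaves n) , ∣leaves∣≡n n)
           , λ S st → isStable⇒∣S∣≤n n S (Stable⇒isStable n S st)

leavesOnly-full⊎extensible : ∀ n S → T (leavesOnly n S) →
  ∣ S ∣ ≡ n ⊎ ∃[ v ] (v ∉ S × T (leavesOnly n (S ∪ ⁅ v ⁆)))
leavesOnly-full⊎extensible zero    []                  _ = inj₁ refl
leavesOnly-full⊎extensible (suc n) (false ∷ false ∷ S) h =
  inj₂ (suc zero , (λ ()) ∘ drop-there , subst (T ∘ leavesOnly n) (sym (∪-identityʳ S)) h)
leavesOnly-full⊎extensible (suc n) (false ∷ true  ∷ S) h =
  Sum.map (cong suc) (λ (v , v∉S , h′) → suc (suc v) , v∉S ∘ drop-there ∘ drop-there , h′)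
          (leavesOnly-full⊎extensible n S h)

isStable-full⊎extensible : ∀ n S → T (isStable n S) →
  ∣ S ∣ ≡ n ⊎ ∃[ v ] (v ∉ S × T (isStable n (S ∪ ⁅ v ⁆)))
isStable-full⊎extensible zero    []                  _ = inj₁ refl
isStable-full⊎extensible (suc n) (false ∷ false ∷ S) h =
  inj₂ (suc zero , (λ ()) ∘ drop-there , subst (T ∘ isStable n) (sym (∪-identityʳ S)) h)
isStable-full⊎extensible (suc n) (false ∷ true  ∷ S) h =
  Sum.map (cong suc) (λ (v , v∉S , h′) → suc (suc v) , v∉S ∘ drop-there ∘ drop-there , h′)
          (isStable-full⊎extensible n S h)
isStable-full⊎extensible (suc n) (true  ∷ false ∷ S) h =
  Sum.map (cong suc) (λ (v , v∉S , h′) → suc (suc v) , v∉S ∘ drop-there ∘ drop-there , h′)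
          (leavesOnly-full⊎extensible n S h)

MaximalStable⇒∣S∣≡n : ∀ n S → MaximalStable (corona n) S → ∣ S ∣ ≡ n
MaximalStable⇒∣S∣≡n n S (st , maximal) with isStable-full⊎extensible n S (Stable⇒isStable n S st)
... | inj₁ ∣S∣≡n            = ∣S∣≡n
... | inj₂ (v , v∉S , st′) = ⊥-elim (maximal v v∉S (isStable⇒Stable n (S ∪ ⁅ v ⁆) st′))

corona-wellCovered : ∀ n → WellCovered (corona n)
corona-wellCovered n S S′ maxS maxS′ =
  trans (MaximalStable⇒∣S∣≡n n S maxS) (sym (MaximalStable⇒∣S∣≡n n S′ maxS′))

corona-noIsolated : ∀ n → NoIsolated (corona n)
corona-noIsolated (suc n) zero          = suc zero , refl
corona-noIsolated (suc n) (suc zero)    = zero , refl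
corona-noIsolated (suc n) (suc (suc v)) with corona-noIsolated n v
... | w , vw = suc (suc w) , vw

leaf⇒cliqueNeighbour : ∀ n v → isClique v ≡ false → ∃[ w ] (Adj (corona n) v w × isClique w ≡ true)
leaf⇒cliqueNeighbour (suc n) (suc zero)    _    = zero , refl , refl
leaf⇒cliqueNeighbour (suc n) (suc (suc v)) leaf with leaf⇒cliqueNeighbour n v leaf
... | w , vw , clique = suc (suc w) , vw , clique

walkToFirstClique : ∀ n v → Walk (corona (suc n)) v zero
walkToFirstClique n zero          = here
walkToFirstClique n (suc zero)    = step refl here
walkToFirstClique n (suc (suc v)) with isClique v in clique
... | true  = step clique here
... | false with leaf⇒cliqueNeighbour n v clique
...   | w , vw , clique′ = step {v = suc (suc w)} vw (step clique′ here)

corona-connected : ∀ n → Connected (corona (suc n))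
corona-connected n = allReach⇒Connected (corona (suc n)) zero (walkToFirstClique n)

corona-hasCycle : ∀ n → HasCycle (corona (3 + n))
corona-hasCycle n =
  triangle⇒HasCycle (corona (3 + n)) {zero} {suc (suc zero)} {suc (suc (suc (suc zero)))}
                    (λ ()) (λ ()) (λ ()) refl refl refl

#subsets-leavesOnly : ∀ n k → #subsets (leavesOnly n) k ≡ n C k
#subsets-leavesOnly zero    zero    = refl
#subsets-leavesOnly zero    (suc k) = refl
#subsets-leavesOnly (suc n) k       =
  trans (#subsets-avoiding-0 (leavesOnly (suc n)) (λ { (_ ∷ _) → refl }) k) (dropLeaf k)
  where
  dropLeaf : ∀ k → #subsets (λ S → leavesOnly (suc n) (false ∷ S)) k ≡ suc n C k
  dropLeaf zero    =
    trans (#subsets-zero (λ S → leavesOnly (suc n) (false ∷ S))) (#subsets-leavesOnly n zero)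
  dropLeaf (suc k) = begin
    #subsets (λ S → leavesOnly (suc n) (false ∷ S)) (suc k)
      ≡⟨ #subsets-suc (λ S → leavesOnly (suc n) (false ∷ S)) k ⟩
    #subsets (leavesOnly n) (suc k) + #subsets (leavesOnly n) k
      ≡⟨ cong₂ _+_ (#subsets-leavesOnly n (suc k)) (#subsets-leavesOnly n k) ⟩
    n C suc k + n C k
      ≡⟨ +-comm (n C suc k) (n C k) ⟩
    n C k + n C suc k
      ≡⟨ nCk+nC[k+1]≡[n+1]C[k+1] n k ⟩
    suc n C suc k ∎
    where open ≡-Reasoning

#subsets-isStable : ∀ n k → #subsets (isStable n) k ≡ suc k * (n C k)
#subsets-isStable zero    zero    = refl
#subsets-isStable zero    (suc k) = sym (*-zeroʳ (2 + k))
#subsets-isStable (suc n) zero    =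
  trans (#subsets-zero (isStable (suc n)))
        (trans (#subsets-zero (λ S → isStable (suc n) (false ∷ S))) (#subsets-isStable n zero))
#subsets-isStable (suc n) (suc k) = begin
  #subsets (isStable (suc n)) (suc k)
    ≡⟨ #subsets-suc (isStable (suc n)) k ⟩
  #subsets (λ S → isStable (suc n) (false ∷ S)) (suc k) + #subsets (λ S → isStable (suc n) (true ∷ S)) k
    ≡⟨ cong₂ _+_ (#subsets-suc (λ S → isStable (suc n) (false ∷ S)) k)
                 (#subsets-avoiding-0 (λ S → isStable (suc n) (true ∷ S)) (λ _ → refl) k) ⟩
  (#subsets (isStable n) (suc k) + #subsets (isStable n) k) + #subsets (leavesOnly n) k
    ≡⟨ cong₂ _+_ (cong₂ _+_ (#subsets-isStable n (suc k)) (#subsets-isStable n k))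
                 (#subsets-leavesOnly n k) ⟩
  ((2 + k) * b₁ + (1 + k) * b₀) + b₀
    ≡⟨ solve 3 (λ k b₀ b₁ → ((con 2 :+ k) :* b₁ :+ (con 1 :+ k) :* b₀) :+ b₀
                 := (con 2 :+ k) :* (b₀ :+ b₁)) refl k b₀ b₁ ⟩
  (2 + k) * (b₀ + b₁)
    ≡⟨ cong ((2 + k) *_) (nCk+nC[k+1]≡[n+1]C[k+1] n k) ⟩
  (2 + k) * (suc n C suc k) ∎
  where
  open ≡-Reasoning
  b₀ = n C k
  b₁ = n C suc k

corona-stableCount : ∀ n k → stableCount (corona n) k ≡ suc k * (n C k)
corona-stableCount n k = begin
  stableCount (corona n) k                   ≡⟨ stableCount≡#subsets (corona n) k ⟩
  #subsets (does ∘ Stable? (corona n)) k     ≡⟨ #subsets-cong (does-Stable? n) k ⟩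
  #subsets (isStable n) k                    ≡⟨ #subsets-isStable n k ⟩
  suc k * (n C k)                            ∎
  where open ≡-Reasoning

corona-unimodal : ∀ n → IndependencePolyUnimodal (corona n)
corona-unimodal n =
  n , corona-α n , UnimodalSeq-cong (sym ∘ corona-stableCount n) ([k+1]*nCk-unimodal n)

corona-veryWellCovered : ∀ n → VeryWellCovered (corona n)
corona-veryWellCovered n =
  corona-wellCovered n , corona-noIsolated n , n , corona-α n , double≡2* n

corollary1 : (n : ℕ) → 3 ≤ n →
    Σ ℕ (λ m → Σ (SimpleGraph m) (λ H →
      Connected H × VeryWellCovered H × ¬ IsTree H × IsAlpha H n
        × IndependencePolyUnimodal H))
corollary1 n@(suc (suc (suc n-3))) _ =
  double n , corona n ,
  corona-connected (2 + n-3) ,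
  corona-veryWellCovered n ,
  (λ (_ , acyclic) → acyclic (corona-hasCycle n-3)) ,
  corona-α n ,
  corona-unimodal n
corollary1 (suc zero)       (s≤s ())
corollary1 (suc (suc zero)) (s≤s (s≤s ()))
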